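{- Let $G$ be a finite simple graph and let $F\subseteq E(G)$ be such that the graph $G-F=(V(G),E(G)\setminus F)$ has no isolated vertices. If $G-F\notin\Omega$, then $G\notin\Omega$.
   Context: A star is a graph isomorphic to $K_{1,n}$ for some $n\ge 1$. A star-factor of $G$ is a spanning subgraph each of whose connected components is a star. An edge-weighting of $G$ is a function $w:E(G)\to\mathbb{N}^+$ (positive integers), and the weight of a subgraph $H$ is $w(H)=\sum_{e\in E(H)}w(e)$. $\Omega$ denotes the family of all graphs $G$ for which there exists an edge-weighting $w$ of $G$ such that all star-factors of $G$ have the same weight under $w$. -}

module Defs where

open import Data.Nat using (ℕ; zero; suc; _+_; _<_; _<ᵇ_)
open import Data.Fin using (Fin; zero; suc; toℕ)
open import Data.Bool using (Bool; true; false; _∧_; not; if_then_else_)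
open import Data.Product using (Σ; ∃; _×_; _,_)
open import Data.Sum using (_⊎_)
open import Relation.Binary.PropositionalEquality using (_≡_; refl; cong₂; sym; trans)
open import Data.Bool.Properties using (∧-comm)

record Graph (n : ℕ) : Set where
  field
    adj    : Fin n → Fin n → Bool
    symm   : ∀ i j → adj i j ≡ adj j i
    irrefl : ∀ i → adj i i ≡ false
open Graph public

_⊆G_ : ∀ {n} → Graph n → Graph n → Set
H ⊆G G = ∀ i j → adj H i j ≡ true → adj G i j ≡ true

record EdgeSet (n : ℕ) : Set where
  field
    mem  : Fin n → Fin n → Bool
    memSym : ∀ i j → mem i j ≡ mem j i
open EdgeSet public

_⊆E_ : ∀ {n} → EdgeSet n → Graph n → Set
F ⊆E G = ∀ i j → mem F i j ≡ true → adj G i j ≡ true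

_─_ : ∀ {n} → Graph n → EdgeSet n → Graph n
G ─ F = record
  { adj = λ i j → adj G i j ∧ not (mem F i j)
  ; symm = λ i j → cong₂ (λ a b → a ∧ not b) (symm G i j) (memSym F i j)
  ; irrefl = λ i → helper (adj G i i) (irrefl G i)
  }
  where
  helper : ∀ {b} a → a ≡ false → a ∧ b ≡ false
  helper .false refl = refl

NoIsolated : ∀ {n} → Graph n → Set
NoIsolated {n} G = ∀ (v : Fin n) → ∃ λ (u : Fin n) → adj G v u ≡ true

data Reach {n} (H : Graph n) : Fin n → Fin n → Set where
  here : ∀ {v} → Reach H v v
  step : ∀ {u v w} → adj H u v ≡ true → Reach H v w → Reach H u w

-- Every connected component of H is a star K_{1,m} with m ≥ 1:
-- the component of v has a centre c such that every edge inside the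
-- component is incident with c, and c has at least one neighbour.
AllComponentsStars : ∀ {n} → Graph n → Set
AllComponentsStars {n} H =
  ∀ (v : Fin n) → Σ (Fin n) λ c →
      Reach H v c
    × (∃ λ (x : Fin n) → adj H c x ≡ true)
    × (∀ (x y : Fin n) → Reach H v x → Reach H v y →
         adj H x y ≡ true → (x ≡ c) ⊎ (y ≡ c))

StarFactor : ∀ {n} → Graph n → Graph n → Set
StarFactor G H = (H ⊆G G) × AllComponentsStars H

sumFin : ∀ n → (Fin n → ℕ) → ℕ
sumFin zero    f = 0
sumFin (suc n) f = f zero + sumFin n (λ i → f (suc i))

-- Edge-weighting: a function on vertex pairs; the weight of the edge {i,j}
-- (i < j) is w i j. Positivity is required on all edges of G.
Weighting : ℕ → Set
Weighting n = Fin n → Fin n → ℕ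

weight : ∀ {n} → Graph n → Weighting n → ℕ
weight {n} H w =
  sumFin n λ i → sumFin n λ j →
    if adj H i j ∧ (toℕ i <ᵇ toℕ j) then w i j else 0

InΩ : ∀ {n} → Graph n → Set
InΩ {n} G = Σ (Weighting n) λ w →
    (∀ i j → adj G i j ≡ true → 0 < w i j)
  × (∀ H H' → StarFactor G H → StarFactor G H' → weight H w ≡ weight H' w)

module Submission where

open import Defs
open import Data.Nat using (ℕ)
open import Data.Bool.Properties using (∧-conicalˡ)
open import Data.Product using (_,_)
open import Function using (_∘_)
open import Relation.Nullary using (¬_)

-- Deleting edges can only shrink the family of star-factors, while any weighting of G
-- restricts to one of G − F; so a weighting witnessing G ∈ Ω also witnesses G − F ∈ Ω.

-- The graphs are explicit because Agda cannot recover them from adjacency relations.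
⊆G-trans : ∀ {n} (G H K : Graph n) → K ⊆G H → H ⊆G G → K ⊆G G
⊆G-trans G H K K⊆H H⊆G i j = H⊆G i j ∘ K⊆H i j

─-⊆G : ∀ {n} (G : Graph n) (F : EdgeSet n) → (G ─ F) ⊆G G
─-⊆G G F i j = ∧-conicalˡ _ _

StarFactor-mono : ∀ {n} (G H S : Graph n) → H ⊆G G → StarFactor H S → StarFactor G S
StarFactor-mono G H S H⊆G (S⊆H , stars) = ⊆G-trans G H S S⊆H H⊆G , stars

InΩ-antitone : ∀ {n} (G H : Graph n) → H ⊆G G → InΩ G → InΩ H
InΩ-antitone G H H⊆G (w , positive , constant) =
    w
  , (λ i j → positive i j ∘ H⊆G i j)
  , (λ S S′ S-factor S′-factor →
       constant S S′ (StarFactor-mono G H S H⊆G S-factor) (StarFactor-mono G H S′ H⊆G S′-factor))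

lemma2p1 : ∀ (n : ℕ) (G : Graph n) (F : EdgeSet n) → F ⊆E G →
    NoIsolated (G ─ F) → ¬ InΩ (G ─ F) → ¬ InΩ G
lemma2p1 n G F _ _ G─F∉Ω = G─F∉Ω ∘ InΩ-antitone G (G ─ F) (─-⊆G G F)
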